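{- Let $n,k,s$ be positive integers with $k\geq 2$, and let $\mathcal{H}\subseteq\binom{[n]}{k}$ with $\nu(\mathcal{H})\leq s$. Then $\nu(\mathcal{K}_{sk+1}(\mathcal{H}))\leq s$.
   Context: $\nu(\mathcal{G})$ is the largest number of pairwise disjoint members of a family $\mathcal{G}$. For $E\subseteq[n]$, $d_{\mathcal{H}}(E)=|\{F\in\mathcal{H}:E\subseteq F\}|$. For an integer $d$, $\mathcal{K}_d(\mathcal{H})=\{K\in\binom{[n]}{k-1}: d_{\mathcal{H}}(K)\geq d\}$. -}

module Defs where

open import Data.Nat using (ℕ; suc; _≤_; _∸_)
open import Data.Fin.Subset using (Subset; _⊆_; _∩_; ⊥; ∣_∣)
open import Data.Fin.Subset.Properties using (_⊆?_)
open import Data.List using (List; length; filter)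
open import Data.List.Relation.Unary.All using (All)
open import Data.List.Relation.Unary.Unique.Propositional using (Unique)
open import Data.List.Relation.Unary.AllPairs using (AllPairs)
open import Relation.Binary.PropositionalEquality using (_≡_)

Disjoint : ∀ {n} → Subset n → Subset n → Set
Disjoint A B = A ∩ B ≡ ⊥

Family : ℕ → Set₁
Family n = Subset n → Set

-- A finite family given as a list without repetitions.
FinFamily : ℕ → Set
FinFamily n = List (Subset n)

members : ∀ {n} → FinFamily n → Family n
members {n} H F = Data.List.Membership.Propositional._∈_ F H
  where import Data.List.Membership.Propositional

record Matching {n} (G : Family n) : Set where
  field
    sets     : List (Subset n)
    distinct : Unique sets
    inG      : All G sets
    disjoint : AllPairs Disjoint sets

νAtMost : ∀ {n} → Family n → ℕ → Set
νAtMost G s = (M : Matching G) → length (Matching.sets M) ≤ s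

Uniform : ∀ {n} → ℕ → FinFamily n → Set
Uniform k H = All (λ F → ∣ F ∣ ≡ k) H

degree : ∀ {n} → FinFamily n → Subset n → ℕ
degree H E = length (filter (E ⊆?_) H)

𝒦 : ∀ {n} → ℕ → ℕ → FinFamily n → Family n
𝒦 k d H K = (∣ K ∣ ≡ k ∸ 1) × (d ≤ degree H K)
  where open import Data.Product using (_×_)

-- A matching K₁, …, K_{s+1} of 𝒦_{sk+1}(H) lifts greedily to a matching
-- F₁, …, F_{s+1} of H with Kᵢ ⊆ Fᵢ.  When Fᵢ is chosen, the points to avoid
-- are those of F₁, …, F_{i-1} and of K_{i+1}, …, K_{s+1}: at most sk of them.
-- The members of H through Kᵢ that meet a set B disjoint from Kᵢ are of the
-- form Kᵢ ∪ {x} with distinct x ∈ B, so there are at most |B| of them, and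
-- degree sk + 1 leaves a member through Kᵢ that avoids B.
module Submission where

open import Defs
open import Data.Nat using (ℕ; suc; _*_; _+_; _≤_; _<_; z≤n; s≤s; z<s)
open import Data.Nat.Properties
open import Algebra.Properties.CommutativeSemigroup +-commutativeSemigroup using (x∙yz≈y∙xz)
open import Data.Fin using (Fin)
import Data.Fin.Properties as Fin
open import Data.Fin.Subset
  using (Subset; inside; outside; _∪_; _∩_; ⁅_⁆; _-_; ⋃; ∣_∣; _∈_; _∉_; _⊆_; _⊂_; Nonempty; ⊥)
open import Data.Fin.Subset.Properties
open import Data.Vec using (_∷_; []; here)
open import Data.List using (List; []; _∷_; length; filter; take)
open import Data.List.Properties using (length-take)
open import Data.List.Relation.Unary.All as All using (All; []; _∷_; all?)
open import Data.List.Relation.Unary.All.Properties using (¬All⇒Any¬; all-filter; filter⁺; take⁺)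
open import Data.List.Relation.Unary.AllPairs using (AllPairs; []; _∷_)
import Data.List.Relation.Unary.AllPairs.Properties as AllPairs
open import Data.List.Relation.Unary.Unique.Propositional using (Unique)
import Data.List.Relation.Unary.Unique.Propositional.Properties as Unique
open import Data.List.Membership.Propositional using (find)
open import Data.List.Membership.Propositional.Properties using (∈-filter⁻)
open import Data.Product using (Σ-syntax; ∃-syntax; _×_; _,_; proj₁; proj₂; map₂)
open import Data.Sum using (inj₂; [_,_]′)
open import Data.Empty renaming (⊥ to ⊥₀) using (⊥-elim)
open import Function using (_∘_)
open import Relation.Nullary using (yes; no)
open import Relation.Binary.PropositionalEquality
  using (_≡_; _≢_; refl; sym; trans; cong; cong₂; subst; module ≡-Reasoning)

private variable
  n : ℕ
  p q r : Subset n
  x : Fin n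

∣p∪q∣≤∣p∣+∣q∣ : ∀ (p q : Subset n) → ∣ p ∪ q ∣ ≤ ∣ p ∣ + ∣ q ∣
∣p∪q∣≤∣p∣+∣q∣ [] [] = z≤n
∣p∪q∣≤∣p∣+∣q∣ (inside ∷ p) (s ∷ q) =
  s≤s (≤-trans (∣p∪q∣≤∣p∣+∣q∣ p q) (+-monoʳ-≤ ∣ p ∣ (∣p∣≤∣x∷p∣ s q)))
∣p∪q∣≤∣p∣+∣q∣ (outside ∷ p) (inside ∷ q) =
  ≤-trans (s≤s (∣p∪q∣≤∣p∣+∣q∣ p q)) (≤-reflexive (sym (+-suc ∣ p ∣ ∣ q ∣)))
∣p∪q∣≤∣p∣+∣q∣ (outside ∷ p) (outside ∷ q) = ∣p∪q∣≤∣p∣+∣q∣ p q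

∣⋃ps∣≤length*k : ∀ {k} (ps : List (Subset n)) → All (λ p → ∣ p ∣ ≤ k) ps →
                 ∣ ⋃ ps ∣ ≤ length ps * k
∣⋃ps∣≤length*k {n} [] [] = ≤-reflexive (∣⊥∣≡0 n)
∣⋃ps∣≤length*k (p ∷ ps) (∣p∣≤k ∷ ∣ps∣≤k) =
  ≤-trans (∣p∪q∣≤∣p∣+∣q∣ p (⋃ ps)) (+-mono-≤ ∣p∣≤k (∣⋃ps∣≤length*k ps ∣ps∣≤k))

p⊆q∧∣q∣≤∣p∣⇒p≡q : ∀ {p q : Subset n} → p ⊆ q → ∣ q ∣ ≤ ∣ p ∣ → p ≡ q
p⊆q∧∣q∣≤∣p∣⇒p≡q {p = []} {[]} _ _ = refl
p⊆q∧∣q∣≤∣p∣⇒p≡q {p = inside ∷ p} {inside ∷ q} p⊆q (s≤s ∣q∣≤∣p∣) =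
  cong (inside ∷_) (p⊆q∧∣q∣≤∣p∣⇒p≡q (drop-∷-⊆ p⊆q) ∣q∣≤∣p∣)
p⊆q∧∣q∣≤∣p∣⇒p≡q {p = inside ∷ p} {outside ∷ q} p⊆q _ with p⊆q here
... | ()
p⊆q∧∣q∣≤∣p∣⇒p≡q {p = outside ∷ p} {inside ∷ q} p⊆q ∣q∣≤∣p∣ =
  ⊥-elim (<⇒≱ ∣q∣≤∣p∣ (p⊆q⇒∣p∣≤∣q∣ (drop-∷-⊆ p⊆q)))
p⊆q∧∣q∣≤∣p∣⇒p≡q {p = outside ∷ p} {outside ∷ q} p⊆q ∣q∣≤∣p∣ =
  cong (outside ∷_) (p⊆q∧∣q∣≤∣p∣⇒p≡q (drop-∷-⊆ p⊆q) ∣q∣≤∣p∣)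

_⋖_ : Subset n → Subset n → Set
p ⋖ q = p ⊆ q × ∣ q ∣ ≡ suc ∣ p ∣

⋖⇒≡∪⁅⁆ : p ⋖ q → x ∉ p → x ∈ q → p ∪ ⁅ x ⁆ ≡ q
⋖⇒≡∪⁅⁆ {p = p} {q} {x} (p⊆q , ∣q∣≡1+∣p∣) x∉p x∈q =
  p⊆q∧∣q∣≤∣p∣⇒p≡q p∪⁅x⁆⊆q (subst (_≤ ∣ p ∪ ⁅ x ⁆ ∣) (sym ∣q∣≡1+∣p∣) (p⊂q⇒∣p∣<∣q∣ p⊂p∪⁅x⁆))
  where
  p∪⁅x⁆⊆q : p ∪ ⁅ x ⁆ ⊆ q
  p∪⁅x⁆⊆q y∈ = [ p⊆q , (λ y∈⁅x⁆ → subst (_∈ q) (sym (x∈⁅y⁆⇒x≡y x y∈⁅x⁆)) x∈q) ]′ (x∈p∪q⁻ p ⁅ x ⁆ y∈)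
  p⊂p∪⁅x⁆ : p ⊂ p ∪ ⁅ x ⁆
  p⊂p∪⁅x⁆ = p⊆p∪q ⁅ x ⁆ , x , x∈p∪q⁺ (inj₂ (x∈⁅x⁆ x)) , x∉p

disjoint⇒∉ : Disjoint p q → x ∈ p → x ∉ q
disjoint⇒∉ {x = x} p∩q≡⊥ x∈p x∈q = ∉⊥ (subst (x ∈_) p∩q≡⊥ (x∈p∩q⁺ (x∈p , x∈q)))

disjoint-sym : Disjoint p q → Disjoint q p
disjoint-sym {p = p} {q} p∩q≡⊥ = trans (∩-comm q p) p∩q≡⊥

disjoint-⊆ʳ : r ⊆ q → Disjoint p q → Disjoint p r
disjoint-⊆ʳ {r = r} {p = p} r⊆q p#q = Empty-unique λ (x , x∈p∩r) →
  let x∈p , x∈r = x∈p∩q⁻ p r x∈p∩r in disjoint⇒∉ p#q x∈p (r⊆q x∈r)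

disjoint-∪ʳ⁺ : Disjoint p q → Disjoint p r → Disjoint p (q ∪ r)
disjoint-∪ʳ⁺ {p = p} {q} {r} p#q p#r = begin
  p ∩ (q ∪ r)        ≡⟨ ∩-distribˡ-∪ p q r ⟩
  p ∩ q ∪ p ∩ r      ≡⟨ cong₂ _∪_ p#q p#r ⟩
  ⊥ ∪ ⊥              ≡⟨ ∪-identityʳ ⊥ ⟩
  ⊥                  ∎
  where open ≡-Reasoning

disjoint-∪ʳ⁻ : Disjoint p (q ∪ r) → Disjoint p q × Disjoint p r
disjoint-∪ʳ⁻ {q = q} {r = r} p#q∪r = disjoint-⊆ʳ (p⊆p∪q r) p#q∪r , disjoint-⊆ʳ (q⊆p∪q q r) p#q∪r

disjoint-⋃⁺ : {qs : List (Subset n)} → All (Disjoint p) qs → Disjoint p (⋃ qs)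
disjoint-⋃⁺ {p = p} [] = ∩-zeroʳ p
disjoint-⋃⁺ (p#q ∷ p#qs) = disjoint-∪ʳ⁺ p#q (disjoint-⋃⁺ p#qs)

disjoint-⋃⁻ : (qs : List (Subset n)) → Disjoint p (⋃ qs) → All (Disjoint p) qs
disjoint-⋃⁻ [] _ = []
disjoint-⋃⁻ (q ∷ qs) p#q∪⋃qs =
  let p#q , p#⋃qs = disjoint-∪ʳ⁻ p#q∪⋃qs in p#q ∷ disjoint-⋃⁻ qs p#⋃qs

AllPairs-Disjoint⇒Unique : {ps : List (Subset n)} → All (_≢ ⊥) ps → AllPairs Disjoint ps → Unique ps
AllPairs-Disjoint⇒Unique [] [] = []
AllPairs-Disjoint⇒Unique {ps = p ∷ _} (p≢⊥ ∷ ps≢⊥) (p#ps ∷ ps#ps) =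
  All.map (λ { p#q refl → p≢⊥ (trans (sym (∩-idem p)) p#q) }) p#ps ∷ AllPairs-Disjoint⇒Unique ps≢⊥ ps#ps

-- Each such F is K ∪ {x} for its point x ∈ F ∩ B, so deleting x from B keeps the others meeting B.
length-covers-meeting≤ : ∀ {K B : Subset n} → Disjoint K B → (L : List (Subset n)) → Unique L →
                         All (K ⋖_) L → All (λ F → Nonempty (F ∩ B)) L → length L ≤ ∣ B ∣
length-covers-meeting≤ _ [] _ _ _ = z≤n
length-covers-meeting≤ {K = K} {B} K#B (F ∷ L) (F∉L ∷ L!) (K⋖F ∷ K⋖L) ((x , x∈F∩B) ∷ L-meet) =
  ≤-trans (s≤s (length-covers-meeting≤ K#B-x L L! K⋖L L-meet-B-x)) (x∈p⇒∣p-x∣<∣p∣ x∈B)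
  where
  x∈F = proj₁ (x∈p∩q⁻ F B x∈F∩B)
  x∈B = proj₂ (x∈p∩q⁻ F B x∈F∩B)
  x∉K : x ∉ K
  x∉K x∈K = disjoint⇒∉ K#B x∈K x∈B
  K#B-x : Disjoint K (B - x)
  K#B-x = disjoint-⊆ʳ (p─q⊆p B ⁅ x ⁆) K#B
  still-meets : ∀ {G} → F ≢ G × K ⋖ G × Nonempty (G ∩ B) → Nonempty (G ∩ (B - x))
  still-meets {G} (F≢G , K⋖G , y , y∈G∩B) with x∈p∩q⁻ G B y∈G∩B | y Fin.≟ x
  ... | y∈G , _   | yes refl = ⊥-elim (F≢G (trans (sym (⋖⇒≡∪⁅⁆ K⋖F x∉K x∈F)) (⋖⇒≡∪⁅⁆ K⋖G x∉K y∈G)))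
  ... | y∈G , y∈B | no y≢x   = y , x∈p∩q⁺ (y∈G , x∈p∧x≢y⇒x∈p-y y∈B y≢x)
  L-meet-B-x : All (λ G → Nonempty (G ∩ (B - x))) L
  L-meet-B-x = All.zipWith still-meets (F∉L , All.zip (K⋖L , L-meet))

∃-member-avoiding : ∀ {H : FinFamily n} {K B} → Unique H → Uniform (suc ∣ K ∣) H →
                    Disjoint K B → ∣ B ∣ < degree H K → ∃[ F ] members H F × Disjoint F B
∃-member-avoiding {H = H} {K} {B} H! H-unif K#B ∣B∣<deg
  with all? (λ F → nonempty? (F ∩ B)) (filter (K ⊆?_) H)
... | yes all-meet = ⊥-elim (<⇒≱ ∣B∣<deg
        (length-covers-meeting≤ K#B _ (Unique.filter⁺ (K ⊆?_) H!)
          (All.zip (all-filter (K ⊆?_) H , filter⁺ (K ⊆?_) H-unif)) all-meet))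
... | no ¬all-meet =
  let F , F∈filter , F∩B-empty = find (¬All⇒Any¬ (λ F → nonempty? (F ∩ B)) _ ¬all-meet)
  in F , proj₁ (∈-filter⁻ (K ⊆?_) F∈filter) , Empty-unique F∩B-empty

module _ {k′ d : ℕ} {H : FinFamily n} (H! : Unique H) (H-unif : Uniform (suc k′) H) where

  private
    k : ℕ
    k = suc k′

  -- The head is lifted avoiding A and the remaining Ks; the bound keeps that set below d ≤ d_H(K)
  -- and survives replacing A by A ∪ F.
  lift-avoiding : (A : Subset n) (Ks : List (Subset n)) → All (𝒦 k d H) Ks → AllPairs Disjoint Ks →
                  All (λ K → Disjoint K A) Ks → length Ks * k + ∣ A ∣ < k + d →
                  ∃[ L ] length L ≡ length Ks × All (λ F → members H F × Disjoint F A) L × AllPairs Disjoint L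
  lift-avoiding A [] _ _ _ _ = [] , refl , [] , []
  lift-avoiding A (K ∷ Ks) ((∣K∣≡k′ , d≤deg) ∷ Ks∈𝒦) (K#Ks ∷ Ks#Ks) (K#A ∷ Ks#A) bound =
    let F , F∈H , F#B = ∃-member-avoiding H! H-unif-K K#B (<-≤-trans ∣B∣<d d≤deg)
        F#⋃Ks , F#A = disjoint-∪ʳ⁻ F#B
        F#Ks = disjoint-⋃⁻ Ks F#⋃Ks
        Ks#F∪A = All.zipWith (λ (F#K′ , K′#A) → disjoint-∪ʳ⁺ (disjoint-sym F#K′) K′#A) (F#Ks , Ks#A)
        L , ∣L∣≡∣Ks∣ , L∈H#F∪A , L#L = lift-avoiding (F ∪ A) Ks Ks∈𝒦 Ks#Ks Ks#F∪A (bound-after F∈H)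
    in F ∷ L
     , cong suc ∣L∣≡∣Ks∣
     , (F∈H , F#A) ∷ All.map (map₂ (proj₂ ∘ disjoint-∪ʳ⁻)) L∈H#F∪A
     , All.map (disjoint-sym ∘ proj₁ ∘ disjoint-∪ʳ⁻ ∘ proj₂) L∈H#F∪A ∷ L#L
    where
    m = length Ks
    B = ⋃ Ks ∪ A

    H-unif-K : Uniform (suc ∣ K ∣) H
    H-unif-K = subst (λ j → Uniform (suc j) H) (sym ∣K∣≡k′) H-unif

    K#B : Disjoint K B
    K#B = disjoint-∪ʳ⁺ (disjoint-⋃⁺ K#Ks) K#A

    bound-before : m * k + ∣ A ∣ < d
    bound-before = +-cancelˡ-< k _ _ (subst (_< k + d) (+-assoc k (m * k) ∣ A ∣) bound)

    ∣B∣<d : ∣ B ∣ < d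
    ∣B∣<d = begin-strict
      ∣ ⋃ Ks ∪ A ∣        ≤⟨ ∣p∪q∣≤∣p∣+∣q∣ (⋃ Ks) A ⟩
      ∣ ⋃ Ks ∣ + ∣ A ∣    ≤⟨ +-monoˡ-≤ ∣ A ∣ (∣⋃ps∣≤length*k Ks (All.map ∣K′∣≤k Ks∈𝒦)) ⟩
      m * k + ∣ A ∣       <⟨ bound-before ⟩
      d                   ∎
      where
      open ≤-Reasoning
      ∣K′∣≤k : ∀ {K′} → 𝒦 k d H K′ → ∣ K′ ∣ ≤ k
      ∣K′∣≤k (∣K′∣≡k′ , _) = ≤-trans (≤-reflexive ∣K′∣≡k′) (n≤1+n k′)

    bound-after : ∀ {F} → members H F → m * k + ∣ F ∪ A ∣ < k + d
    bound-after {F} F∈H = begin-strict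
      m * k + ∣ F ∪ A ∣        ≤⟨ +-monoʳ-≤ (m * k) (∣p∪q∣≤∣p∣+∣q∣ F A) ⟩
      m * k + (∣ F ∣ + ∣ A ∣)  ≡⟨ cong (λ j → m * k + (j + ∣ A ∣)) (All.lookup H-unif F∈H) ⟩
      m * k + (k + ∣ A ∣)      ≡⟨ x∙yz≈y∙xz (m * k) k ∣ A ∣ ⟩
      k + (m * k + ∣ A ∣)      <⟨ +-monoʳ-< k bound-before ⟩
      k + d                    ∎
      where open ≤-Reasoning

  lift-matching : (Ks : List (Subset n)) → All (𝒦 k d H) Ks → AllPairs Disjoint Ks → length Ks * k < k + d →
                  Σ[ M ∈ Matching (members H) ] length (Matching.sets M) ≡ length Ks
  lift-matching Ks Ks∈𝒦 Ks#Ks bound =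
    let L , ∣L∣≡∣Ks∣ , L∈H#⊥ , L#L = lift-avoiding ⊥ Ks Ks∈𝒦 Ks#Ks (All.tabulate λ {K} _ → ∩-zeroʳ K) bound-⊥
        L∈H = All.map proj₁ L∈H#⊥
    in record { sets = L ; distinct = AllPairs-Disjoint⇒Unique (All.map member≢⊥ L∈H) L#L ; inG = L∈H ; disjoint = L#L }
     , ∣L∣≡∣Ks∣
    where
    bound-⊥ : length Ks * k + ∣ ⊥ {n} ∣ < k + d
    bound-⊥ = subst (_< k + d) (sym (trans (cong (length Ks * k +_) (∣⊥∣≡0 n)) (+-identityʳ _))) bound

    member≢⊥ : ∀ {F} → members H F → F ≢ ⊥
    member≢⊥ F∈H refl = 0≢1+n (trans (sym (∣⊥∣≡0 n)) (All.lookup H-unif F∈H))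

lemma2p4 : (n k s : ℕ) → 1 ≤ n → 2 ≤ k → 1 ≤ s →
    (H : FinFamily n) → Unique H → Uniform k H →
    νAtMost (members H) s →
    νAtMost (𝒦 k (s * k + 1) H) s
lemma2p4 n (suc k′) s _ (s≤s _) _ H H! H-unif ν≤s M = ≮⇒≥ s<m-impossible
  where
  open Matching M
  Ks = take (suc s) sets

  s<m-impossible : s < length sets → ⊥₀
  s<m-impossible s<m =
    let M′ , ∣M′∣≡∣Ks∣ = lift-matching H! H-unif Ks (take⁺ (suc s) inG) (AllPairs.take⁺ (suc s) disjoint) bound
    in 1+n≰n (subst (_≤ s) (trans ∣M′∣≡∣Ks∣ ∣Ks∣≡1+s) (ν≤s M′))
    where
    ∣Ks∣≡1+s : length Ks ≡ suc s
    ∣Ks∣≡1+s = trans (length-take (suc s) sets) (m≤n⇒m⊓n≡m s<m)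

    bound : length Ks * suc k′ < suc k′ + (s * suc k′ + 1)
    bound = subst (λ m → m * suc k′ < suc k′ + (s * suc k′ + 1)) (sym ∣Ks∣≡1+s)
                  (+-monoʳ-< (suc k′) (m<m+n (s * suc k′) z<s))
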